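{- For every special fan functional $\Theta$ there is a functional $T:\mathbb N^{\mathbb N}\times(2^{\mathbb N}\to2^{\mathbb N})\to 2^{\mathbb N}$, Kleene-primitive recursive in $\mu$ and $\Theta$ uniformly (i.e.\ via a fixed index not depending on $\Theta$), such that whenever $f\in\mathbb N^{\mathbb N}$ codes a well-ordering $<_f$, then for all $F:2^{\mathbb N}\to2^{\mathbb N}$ and all $a$ in the domain of $<_f$: $$\{b:\langle b,a\rangle\in T(f,F)\}=F(\{\langle c,d\rangle\in T(f,F): d<_f a\}).$$
   Context: $C=2^{\mathbb N}$; $C_s$ is the set of $g\in C$ extending the finite binary sequence $s$; $\bar g n=\langle g(0),\dots,g(n-1)\rangle$. A special fan functional is a functional $\Theta$ assigning to every $G:\mathbb N^{\mathbb N}\to\mathbb N$ a finite sequence $\Theta(G)=\langle g_1,\dots,g_k\rangle$ in $C$ with $C=\bigcup_{i}C_{\bar g_i(G(g_i))}$. $\mu$ is Feferman's search operator ($\mu(h)$ = least $n$ with $h(n)=0$ if one exists). Kleene primitive recursion means computation by the Kleene schemes S1–S8 (without the enumeration scheme S9), with $\Theta$ and $\mu$ as oracles applied to total arguments. Subsets of $\mathbb N$ are identified with their characteristic functions in $2^{\mathbb N}$, and $\langle\cdot,\cdot\rangle$ is a pairing function. -}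

module Defs where

open import Data.Nat using (ℕ; zero; suc; _+_; _≤_; _<_; _≡ᵇ_)
open import Data.Bool using (Bool; true; false; _∧_; not; if_then_else_)
open import Data.List using (List; []; _∷_; length)
open import Data.List.Relation.Unary.All using (All)
open import Data.List.Relation.Unary.Any using (Any)
open import Data.Product using (_×_; _,_; ∃)
open import Data.Sum using (_⊎_)
open import Relation.Binary.PropositionalEquality using (_≡_; _≢_)
open import Induction.WellFounded using (WellFounded)

tri : ℕ → ℕ
tri zero    = 0
tri (suc n) = tri n + suc n

pair : ℕ → ℕ → ℕ
pair x y = tri (x + y) + y

-- unpair enumerates the pairs in Cantor order:
-- (0,0), (1,0), (0,1), (2,0), (1,1), (0,2), ...
unpair : ℕ → ℕ × ℕ
unpair zero = (0 , 0)
unpair (suc n) with unpair n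
... | (zero  , y) = (suc y , 0)
... | (suc x , y) = (x , suc y)

Binary : (ℕ → ℕ) → Set
Binary g = ∀ n → g n ≤ 1

IsFeferman : ((ℕ → ℕ) → ℕ) → Set
IsFeferman μ = ∀ h →
  ((∃ λ n → h n ≡ 0) → (h (μ h) ≡ 0 × (∀ m → m < μ h → h m ≢ 0)))
  × ((∀ n → h n ≢ 0) → μ h ≡ 0)

-- Θ(G) = ⟨g₁,…,g_k⟩ with all gᵢ ∈ C and C = ⋃ᵢ C_{ḡᵢ(G(gᵢ))}
IsSpecialFan : (((ℕ → ℕ) → ℕ) → List (ℕ → ℕ)) → Set
IsSpecialFan Θ = ∀ G →
  All Binary (Θ G)
  × (∀ h → Binary h → Any (λ g → ∀ k → k < G g → h k ≡ g k) (Θ G))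

-- functionals are extensional (as set-theoretic functions are)
ExtΘ : (((ℕ → ℕ) → ℕ) → List (ℕ → ℕ)) → Set
ExtΘ Θ = ∀ G G' → (∀ g → G g ≡ G' g) → Θ G ≡ Θ G'

ExtF : ((ℕ → Bool) → (ℕ → Bool)) → Set
ExtF F = ∀ X Y → (∀ n → X n ≡ Y n) → ∀ n → F X n ≡ F Y n

-- Finite types and Kleene's schemes S1–S8 (no S9), relative to
-- oracles μ (type 2) and Θ (type 3, list-valued) applied to total arguments.

data Ty : Set where
  ι  : Ty
  ar : Ty → Ty

⟦_⟧ : Ty → Set
⟦ ι ⟧    = ℕ
⟦ ar σ ⟧ = ⟦ σ ⟧ → ℕ

data Env : List Ty → Set where
  []  : Env []
  _∷_ : ∀ {σ Γ} → ⟦ σ ⟧ → Env Γ → Env (σ ∷ Γ)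

data _∈ᵗ_ (σ : Ty) : List Ty → Set where
  here  : ∀ {Γ} → σ ∈ᵗ (σ ∷ Γ)
  there : ∀ {τ Γ} → σ ∈ᵗ Γ → σ ∈ᵗ (τ ∷ Γ)

remove : ∀ {σ} (Γ : List Ty) → σ ∈ᵗ Γ → List Ty
remove (_ ∷ Γ) here      = Γ
remove (τ ∷ Γ) (there v) = τ ∷ remove Γ v

get : ∀ {σ Γ} → (v : σ ∈ᵗ Γ) → Env Γ → ⟦ σ ⟧
get here      (x ∷ ρ) = x
get (there v) (x ∷ ρ) = get v ρ

drop : ∀ {σ Γ} → (v : σ ∈ᵗ Γ) → Env Γ → Env (remove Γ v)
drop here      (x ∷ ρ) = ρ
drop (there v) (x ∷ ρ) = x ∷ drop v ρ

data Prog : List Ty → Set where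
  s1 : ∀ {Γ} → Prog (ι ∷ Γ)
  s2 : ∀ {Γ} → ℕ → Prog Γ
  s3 : ∀ {Γ} → Prog (ι ∷ Γ)
  s4 : ∀ {Γ} → Prog (ι ∷ Γ) → Prog Γ → Prog Γ
  s5 : ∀ {Γ} → Prog Γ → Prog (ι ∷ ι ∷ Γ) → Prog (ι ∷ Γ)
  s6 : ∀ {σ Γ} → (v : σ ∈ᵗ Γ) → Prog (σ ∷ remove Γ v) → Prog Γ
  s7 : ∀ {Γ} → Prog (ar ι ∷ ι ∷ Γ)
  s8 : ∀ {σ Γ} → Prog (σ ∷ ar (ar σ) ∷ Γ) → Prog (ar (ar σ) ∷ Γ)
  oμ : ∀ {Γ} → Prog (ι ∷ Γ) → Prog Γ
  oΘlen : ∀ {Γ} → Prog (ar ι ∷ Γ) → Prog Γ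
  -- oracle Θ, value gᵢ(m) where Θ(λg.{e'}(g, x⃗)) = ⟨g₀,…⟩, i = {e₁}(x⃗), m = {e₂}(x⃗)
  -- (0 if i is out of range)
  oΘelt : ∀ {Γ} → Prog (ar ι ∷ Γ) → Prog Γ → Prog Γ → Prog Γ

nth : List (ℕ → ℕ) → ℕ → (ℕ → ℕ)
nth []      _       = λ _ → 0
nth (g ∷ _) zero    = g
nth (_ ∷ l) (suc i) = nth l i

module Eval (μ : (ℕ → ℕ) → ℕ) (Θ : ((ℕ → ℕ) → ℕ) → List (ℕ → ℕ)) where
  mutual
    eval : ∀ {Γ} → Prog Γ → Env Γ → ℕ
    eval s1 (x ∷ ρ) = suc x
    eval (s2 q) ρ = q
    eval s3 (x ∷ ρ) = x
    eval (s4 e₁ e₂) ρ = eval e₁ (eval e₂ ρ ∷ ρ)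
    eval (s5 e₁ e₂) (n ∷ ρ) = evalRec e₁ e₂ ρ n
    eval (s6 v e) ρ = eval e (get v ρ ∷ drop v ρ)
    eval s7 (f ∷ x ∷ ρ) = f x
    eval (s8 e) (F ∷ ρ) = F (λ y → eval e (y ∷ F ∷ ρ))
    eval (oμ e) ρ = μ (λ n → eval e (n ∷ ρ))
    eval (oΘlen e) ρ = length (Θ (λ g → eval e (g ∷ ρ)))
    eval (oΘelt e e₁ e₂) ρ = nth (Θ (λ g → eval e (g ∷ ρ))) (eval e₁ ρ) (eval e₂ ρ)

    evalRec : ∀ {Γ} → Prog Γ → Prog (ι ∷ ι ∷ Γ) → Env Γ → ℕ → ℕ
    evalRec e₁ e₂ ρ zero    = eval e₁ ρ
    evalRec e₁ e₂ ρ (suc n) = eval e₂ (evalRec e₁ e₂ ρ n ∷ n ∷ ρ)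

-- arguments: f ∈ ℕ^ℕ, F (as a type-2 object), n (the argument of T(f,F))
CtxT : List Ty
CtxT = ar ι ∷ ar (ar ι) ∷ ι ∷ []

toBool : ℕ → Bool
toBool zero    = false
toBool (suc _) = true

fromBool : Bool → ℕ
fromBool false = 0
fromBool true  = 1

encF : ((ℕ → Bool) → (ℕ → Bool)) → (ℕ → ℕ) → ℕ
encF F g = fromBool (F (λ k → toBool (g (suc k))) (g 0))

Tfun : Prog CtxT → ((ℕ → ℕ) → ℕ) → (((ℕ → ℕ) → ℕ) → List (ℕ → ℕ))
     → (ℕ → ℕ) → ((ℕ → Bool) → (ℕ → Bool)) → ℕ → ℕ
Tfun e μ Θ f F n = Eval.eval μ Θ e (f ∷ encF F ∷ n ∷ [])

_≤[_]_ : ℕ → (ℕ → ℕ) → ℕ → Set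
x ≤[ f ] y = f (pair x y) ≡ 0

_<[_]_ : ℕ → (ℕ → ℕ) → ℕ → Set
x <[ f ] y = x ≤[ f ] y × x ≢ y

Field : (ℕ → ℕ) → ℕ → Set
Field f x = x ≤[ f ] x

IsWellOrdering : (ℕ → ℕ) → Set
IsWellOrdering f =
  (∀ x y → x ≤[ f ] y → Field f x × Field f y)
  × (∀ x y → x ≤[ f ] y → y ≤[ f ] x → x ≡ y)
  × (∀ x y z → x ≤[ f ] y → y ≤[ f ] z → x ≤[ f ] z)
  × (∀ x y → Field f x → Field f y → x ≤[ f ] y ⊎ y ≤[ f ] x)
  × WellFounded (λ x y → x <[ f ] y)

below : (ℕ → ℕ) → ℕ → (ℕ → ℕ) → ℕ → Bool
below f a t k with unpair k
... | (c , d) = (t k ≡ᵇ 1) ∧ (f (pair d a) ≡ᵇ 0) ∧ not (d ≡ᵇ a)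

-- A candidate g ∈ C fails at n = ⟨b , a⟩ if a lies in the field of <_f and
-- g(n) ≠ F({⟨c , d⟩ ∈ g : d <_f a})(b). With μ one decides whether g fails
-- anywhere, and finds the first failure n whose column a is <_f-minimal among
-- the columns of failures; set G(g) = n + 1, or 0 if g never fails. Θ(G) is a
-- finite list of candidates, and T is the first of them that never fails.
-- Such a candidate exists: let X be the solution of the recursion, obtained by
-- well-founded recursion on <_f, and take g ∈ Θ(G) agreeing with X below G(g).
-- If g failed, at its first minimal failure n = ⟨b , a⟩ we would have g(n) = X(n),
-- and by <_f-induction g agrees with X in every column below a, as none of them
-- contains a failure; so g satisfies the recursion at n, a contradiction. A
-- candidate that never fails satisfies the recursion at every ⟨b , a⟩.

module Submission where

open import Defs
open import Data.Nat using (ℕ; zero; suc; _+_; _∸_; _≤_; _<_; _≡ᵇ_; z≤n; s≤s; pred)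
open import Data.Nat.Properties
open import Data.Bool using (Bool; true; false; _∧_; not; _xor_; if_then_else_)
open import Data.Bool.Properties using (∧-identityʳ; ∧-zeroʳ)
open import Data.List using (List; []; _∷_; length)
open import Data.List.Relation.Unary.All using (All; _∷_)
open import Data.List.Relation.Unary.Any using (Any; here; there)
open import Data.Product using (Σ; _×_; _,_; proj₁; proj₂; ∃)
open import Data.Sum using (_⊎_; inj₁; inj₂)
open import Data.Unit using (⊤; tt)
open import Data.Empty using (⊥; ⊥-elim)
open import Relation.Nullary using (¬_; contradiction)
open import Relation.Nullary.Reflects using (Reflects; ofʸ; ofⁿ; fromEquivalence; _×-reflects_; ¬-reflects)
open import Induction.WellFounded using (WellFounded; Acc; acc)
open import Relation.Binary using (tri<; tri≈; tri>)
open import Relation.Binary.PropositionalEquality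
open ≡-Reasoning

Ren : List Ty → List Ty → Set
Ren Γ Δ = ∀ {τ} → τ ∈ᵗ Γ → τ ∈ᵗ Δ

lift : ∀ {σ Γ Δ} → Ren Γ Δ → Ren (σ ∷ Γ) (σ ∷ Δ)
lift r here      = here
lift r (there w) = there (r w)

unremove : ∀ {σ Γ} (v : σ ∈ᵗ Γ) → Ren (remove Γ v) Γ
unremove here      w         = there w
unremove (there v) here      = here
unremove (there v) (there w) = there (unremove v w)

toFront : ∀ {σ Γ} (v : σ ∈ᵗ Γ) → Ren Γ (σ ∷ remove Γ v)
toFront here      here      = here
toFront here      (there u) = there u
toFront (there v) here      = there here
toFront (there v) (there u) = lift there (toFront v u)

fromFront : ∀ {σ Γ Δ} → Ren Γ Δ → (v : σ ∈ᵗ Γ) → Ren (σ ∷ remove Γ v) Δ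
fromFront r v here      = r v
fromFront r v (there w) = r (unremove v w)

get-unremove : ∀ {σ τ Γ} (v : σ ∈ᵗ Γ) (w : τ ∈ᵗ remove Γ v) (ρ : Env Γ) →
               get (unremove v w) ρ ≡ get w (drop v ρ)
get-unremove here      w         (x ∷ ρ) = refl
get-unremove (there v) here      (x ∷ ρ) = refl
get-unremove (there v) (there w) (x ∷ ρ) = get-unremove v w ρ

get-lift-there : ∀ {σ τ υ Γ} (w : τ ∈ᵗ (σ ∷ Γ)) (x : ⟦ σ ⟧) (y : ⟦ υ ⟧) (ρ : Env Γ) →
                 get (lift there w) (x ∷ y ∷ ρ) ≡ get w (x ∷ ρ)
get-lift-there here      x y ρ = refl
get-lift-there (there w) x y ρ = refl

get-toFront : ∀ {σ τ Γ} (v : σ ∈ᵗ Γ) (u : τ ∈ᵗ Γ) (ρ : Env Γ) →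
              get (toFront v u) (get v ρ ∷ drop v ρ) ≡ get u ρ
get-toFront here      here      (x ∷ ρ) = refl
get-toFront here      (there u) (x ∷ ρ) = refl
get-toFront (there v) here      (x ∷ ρ) = refl
get-toFront (there v) (there u) (x ∷ ρ) =
  trans (get-lift-there (toFront v u) (get v ρ) x (drop v ρ)) (get-toFront v u ρ)

-- Variables are permuted with S6, and S1, S3, S5, S7, S8 (which act on the
-- leading arguments) are preceded by an S6 fetching those arguments.
rename : ∀ {Γ Δ} → Ren Γ Δ → Prog Γ → Prog Δ
rename r s1              = s6 (r here) s1
rename r (s2 q)          = s2 q
rename r s3              = s6 (r here) s3
rename r (s4 e₁ e₂)      = s4 (rename (lift r) e₁) (rename r e₂)
rename r (s5 e₁ e₂)      =
  s4 (s5 (rename (λ w → r (there w)) e₁) (rename (lift (lift (λ w → r (there w)))) e₂))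
     (s6 (r here) s3)
rename r (s6 v e)        = rename (fromFront r v) e
rename r s7              = s4 (s6 (there (r here)) s7) (s6 (r (there here)) s3)
rename r (s8 e)          = s6 (r here) (s8 (rename (lift (λ w → toFront (r here) (r w))) e))
rename r (oμ e)          = oμ (rename (lift r) e)
rename r (oΘlen e)       = oΘlen (rename (lift r) e)
rename r (oΘelt e e₁ e₂) = oΘelt (rename (lift r) e) (rename r e₁) (rename r e₂)

weaken : ∀ {σ Γ} → Prog Γ → Prog (σ ∷ Γ)
weaken = rename there

weaken₂ : ∀ {σ τ Γ} → Prog Γ → Prog (σ ∷ τ ∷ Γ)
weaken₂ = rename (λ w → there (there w))

-- Arguments of type three and higher never occur; excluding them makes S8 extensional.
Extensional : (σ : Ty) → ⟦ σ ⟧ → Set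
Extensional ι                _ = ⊤
Extensional (ar ι)           _ = ⊤
Extensional (ar (ar ι))      F = ∀ h h' → (∀ x → h x ≡ h' x) → F h ≡ F h'
Extensional (ar (ar (ar σ))) _ = ⊥

ExtensionalEnv : ∀ {Γ} → Env Γ → Set
ExtensionalEnv []                = ⊤
ExtensionalEnv (_∷_ {σ} x ρ) = Extensional σ x × ExtensionalEnv ρ

extensional-get : ∀ {σ Γ} {ρ : Env Γ} → ExtensionalEnv ρ → (v : σ ∈ᵗ Γ) → Extensional σ (get v ρ)
extensional-get {ρ = x ∷ ρ} (ex , _)  here      = ex
extensional-get {ρ = x ∷ ρ} (_ , exρ) (there v) = extensional-get exρ v

extensional-drop : ∀ {σ Γ} {ρ : Env Γ} → ExtensionalEnv ρ → (v : σ ∈ᵗ Γ) → ExtensionalEnv (drop v ρ)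
extensional-drop {ρ = x ∷ ρ} (_ , exρ)  here      = exρ
extensional-drop {ρ = x ∷ ρ} (ex , exρ) (there v) = ex , extensional-drop exρ v

Along : ∀ {Γ Δ} → Ren Γ Δ → Env Γ → Env Δ → Set
Along {Γ} r ρ ρ' = ∀ {τ} (w : τ ∈ᵗ Γ) → get (r w) ρ' ≡ get w ρ

along-lift : ∀ {σ Γ Δ} {r : Ren Γ Δ} {ρ ρ'} (x : ⟦ σ ⟧) → Along r ρ ρ' → Along (lift r) (x ∷ ρ) (x ∷ ρ')
along-lift x al here      = refl
along-lift x al (there w) = al w

module Renaming (μ : (ℕ → ℕ) → ℕ) (Θ : ((ℕ → ℕ) → ℕ) → List (ℕ → ℕ))
                (μ-ext : ∀ h h' → (∀ n → h n ≡ h' n) → μ h ≡ μ h') (Θ-ext : ExtΘ Θ) where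
  open Eval μ Θ

  mutual
    eval-rename : ∀ {Γ Δ} (r : Ren Γ Δ) (e : Prog Γ) {ρ : Env Γ} {ρ' : Env Δ} →
                  ExtensionalEnv ρ' → Along r ρ ρ' → eval (rename r e) ρ' ≡ eval e ρ
    eval-rename r s1 {x ∷ ρ} ex al = cong suc (al here)
    eval-rename r (s2 q) ex al = refl
    eval-rename r s3 {x ∷ ρ} ex al = al here
    eval-rename r (s4 e₁ e₂) {ρ' = ρ'} ex al =
      trans (cong (λ v → eval (rename (lift r) e₁) (v ∷ ρ')) (eval-rename r e₂ ex al))
            (eval-rename (lift r) e₁ (tt , ex) (along-lift _ al))
    eval-rename r (s5 e₁ e₂) {n ∷ ρ} {ρ'} ex al =
      trans (cong (evalRec _ _ ρ') (al here))
            (evalRec-rename (λ w → r (there w)) e₁ e₂ ex (λ w → al (there w)) n)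
    eval-rename r (s6 v e) {ρ} ex al = eval-rename (fromFront r v) e ex along
      where
      along : Along (fromFront r v) (get v ρ ∷ drop v ρ) _
      along here      = al v
      along (there w) = trans (al (unremove v w)) (get-unremove v w ρ)
    eval-rename r s7 {f ∷ x ∷ ρ} ex al = cong₂ (λ g y → g y) (al here) (al (there here))
    eval-rename r (s8 {σ = ι} e) {F ∷ ρ} {ρ'} ex al =
      trans (extensional-get ex (r here) _ _ λ y →
               eval-rename r' e (tt , extensional-get ex (r here) , extensional-drop ex (r here)) (along y))
            (cong (λ G → G (λ y → eval e (y ∷ F ∷ ρ))) (al here))
      where
      r' = lift (λ w → toFront (r here) (r w))
      along : ∀ y → Along r' (y ∷ F ∷ ρ) (y ∷ get (r here) ρ' ∷ drop (r here) ρ')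
      along y here      = refl
      along y (there w) = trans (get-toFront (r here) (r w) ρ') (al w)
    eval-rename r (s8 {σ = ar τ} e) ex al = ⊥-elim (extensional-get ex (r here))
    eval-rename r (oμ e) ex al =
      μ-ext _ _ λ n → eval-rename (lift r) e (tt , ex) (along-lift n al)
    eval-rename r (oΘlen e) ex al =
      cong length (Θ-ext _ _ λ g → eval-rename (lift r) e (tt , ex) (along-lift g al))
    eval-rename r (oΘelt e e₁ e₂) ex al =
      cong₃ nth (Θ-ext _ _ λ g → eval-rename (lift r) e (tt , ex) (along-lift g al))
                (eval-rename r e₁ ex al) (eval-rename r e₂ ex al)
      where
      cong₃ : ∀ {A B C D : Set} (h : A → B → C → D) {a a' b b' c c'} →
              a ≡ a' → b ≡ b' → c ≡ c' → h a b c ≡ h a' b' c'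
      cong₃ h refl refl refl = refl

    evalRec-rename : ∀ {Γ Δ} (r : Ren Γ Δ) (e₁ : Prog Γ) (e₂ : Prog (ι ∷ ι ∷ Γ)) {ρ : Env Γ} {ρ' : Env Δ} →
                     ExtensionalEnv ρ' → Along r ρ ρ' →
                     ∀ n → evalRec (rename r e₁) (rename (lift (lift r)) e₂) ρ' n ≡ evalRec e₁ e₂ ρ n
    evalRec-rename r e₁ e₂ ex al zero = eval-rename r e₁ ex al
    evalRec-rename r e₁ e₂ {ρ' = ρ'} ex al (suc n) =
      trans (cong (λ v → eval (rename (lift (lift r)) e₂) (v ∷ n ∷ ρ')) (evalRec-rename r e₁ e₂ ex al n))
            (eval-rename (lift (lift r)) e₂ (tt , tt , ex) (along-lift _ (along-lift n al)))

  eval-weaken : ∀ {σ Γ} (e : Prog Γ) {x : ⟦ σ ⟧} {ρ : Env Γ} → ExtensionalEnv (x ∷ ρ) →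
                eval (weaken e) (x ∷ ρ) ≡ eval e ρ
  eval-weaken e ex = eval-rename there e ex (λ w → refl)

  eval-weaken₂ : ∀ {σ τ Γ} (e : Prog Γ) {x : ⟦ σ ⟧} {y : ⟦ τ ⟧} {ρ : Env Γ} → ExtensionalEnv (x ∷ y ∷ ρ) →
                 eval (weaken₂ e) (x ∷ y ∷ ρ) ≡ eval e ρ
  eval-weaken₂ e ex = eval-rename (λ w → there (there w)) e ex (λ w → refl)

unpair₁ unpair₂ : ℕ → ℕ
unpair₁ k = proj₁ (unpair k)
unpair₂ k = proj₂ (unpair k)

tri-mono-≤ : ∀ {m n} → m ≤ n → tri m ≤ tri n
tri-mono-≤ {zero}  {n}     _         = z≤n
tri-mono-≤ {suc m} {suc n} (s≤s m≤n) = +-mono-≤ (tri-mono-≤ m≤n) (s≤s m≤n)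

pair-suc-y : ∀ x y → pair x (suc y) ≡ suc (pair (suc x) y)
pair-suc-y x y = trans (cong (λ s → tri s + suc y) (+-suc x y)) (+-suc _ y)

pair-suc-x-0 : ∀ x → pair (suc x) 0 ≡ suc (pair 0 x)
pair-suc-x-0 x = begin
  tri (suc x + 0) + 0 ≡⟨ +-identityʳ _ ⟩
  tri (suc x + 0)     ≡⟨ cong tri (+-identityʳ (suc x)) ⟩
  tri x + suc x       ≡⟨ +-suc (tri x) x ⟩
  suc (pair 0 x)      ∎

unpair-pair : ∀ x y → unpair (pair x y) ≡ (x , y)
unpair-pair x y = go (x + y) x y refl
  where
  go : ∀ s x y → x + y ≡ s → unpair (pair x y) ≡ (x , y)
  go s       x       (suc y) eq rewrite pair-suc-y x y | go s (suc x) y (trans (sym (+-suc x y)) eq) = refl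
  go (suc s) (suc x) zero    eq rewrite pair-suc-x-0 x | go s 0 x (suc-injective (trans (sym (+-identityʳ (suc x))) eq)) = refl
  go zero    zero    zero    eq = refl
  go zero    (suc x) zero    ()
  go (suc s) zero    zero    ()

pair-unpair : ∀ k → pair (unpair₁ k) (unpair₂ k) ≡ k
pair-unpair zero = refl
pair-unpair (suc k) with unpair k | pair-unpair k
... | zero  , y | ih = trans (pair-suc-x-0 y) (cong suc ih)
... | suc x , y | ih = trans (pair-suc-y x y) (cong suc ih)

-- A test is a program whose value 0 stands for true.
holds : ℕ → Bool
holds n = n ≡ᵇ 0

code : Bool → ℕ
code true  = 0
code false = 1

holds-code : ∀ b → holds (code b) ≡ b
holds-code true  = refl
holds-code false = refl

zero-transfer : ∀ {m n} → holds m ≡ holds n → m ≡ 0 → n ≡ 0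
zero-transfer {n = zero}  _  _    = refl
zero-transfer {n = suc n} () refl

module Feferman (μ : (ℕ → ℕ) → ℕ) (μ-spec : IsFeferman μ) where

  μ-least : ∀ (h : ℕ → ℕ) n → h n ≡ 0 → (∀ m → m < n → h m ≢ 0) → μ h ≡ n
  μ-least h n hn n-least with proj₁ (μ-spec h) (n , hn)
  ... | hμ , μ-least' with <-cmp (μ h) n
  ...   | tri< μ<n _ _ = ⊥-elim (n-least (μ h) μ<n hμ)
  ...   | tri≈ _ μ≡n _ = μ≡n
  ...   | tri> _ _ n<μ = ⊥-elim (μ-least' n n<μ hn)

  μ-zero-or-none : ∀ (h : ℕ → ℕ) → h (μ h) ≡ 0 ⊎ (∀ n → h n ≢ 0)
  μ-zero-or-none h with h (μ h) in eq
  ... | zero  = inj₁ refl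
  ... | suc _ = inj₂ λ n hn → 0≢1+n (trans (sym (proj₁ (proj₁ (μ-spec h) (n , hn)))) eq)

  μ-cong₀ : ∀ (h h' : ℕ → ℕ) → (∀ n → holds (h n) ≡ holds (h' n)) → μ h ≡ μ h'
  μ-cong₀ h h' same with μ-zero-or-none h
  ... | inj₁ hμ = sym (μ-least h' (μ h) (zero-transfer (same (μ h)) hμ)
                     λ m m<μ h'm → proj₂ (proj₁ (μ-spec h) (μ h , hμ)) m m<μ (zero-transfer (sym (same m)) h'm))
  ... | inj₂ none = trans (proj₂ (μ-spec h) none)
                          (sym (proj₂ (μ-spec h') λ n h'n → none n (zero-transfer (sym (same n)) h'n)))

  μ-ext : ∀ (h h' : ℕ → ℕ) → (∀ n → h n ≡ h' n) → μ h ≡ μ h'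
  μ-ext h h' eq = μ-cong₀ h h' (λ n → cong holds (eq n))

  search : (ℕ → Bool) → ℕ
  search p = μ (λ n → code (p n))

  μ-search : ∀ (h : ℕ → ℕ) p → (∀ n → holds (h n) ≡ p n) → μ h ≡ search p
  μ-search h p hp = μ-cong₀ h _ λ n → trans (hp n) (sym (holds-code (p n)))

  search-finds : ∀ (p : ℕ → Bool) n → p n ≡ true → p (search p) ≡ true
  search-finds p n pn = begin
    p (search p)                ≡⟨ sym (holds-code _) ⟩
    holds (code (p (search p))) ≡⟨ cong holds (proj₁ (proj₁ (μ-spec (λ m → code (p m))) (n , cong code pn))) ⟩
    true                        ∎

  search-misses : ∀ (p : ℕ → Bool) → p (search p) ≡ false → ∀ n → p n ≡ false
  search-misses p miss n with p n in pn
  ... | false = refl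
  ... | true  = contradiction (trans (sym (search-finds p n pn)) miss) λ ()

  -- ⟨x , y⟩ lies on the diagonal x + y, the least s with ⟨x , y⟩ < tri (s + 1).
  diagonal : ℕ → ℕ
  diagonal k = μ (λ s → suc k ∸ tri (suc s))

  diagonal-pair : ∀ x y → diagonal (pair x y) ≡ x + y
  diagonal-pair x y = μ-least _ (x + y) below-next above-earlier
    where
    below-next : suc (pair x y) ∸ tri (suc (x + y)) ≡ 0
    below-next = m≤n⇒m∸n≡0
      (subst (_≤ tri (suc (x + y))) (+-suc (tri (x + y)) y) (+-monoʳ-≤ (tri (x + y)) (s≤s (m≤n+m y x))))
    above-earlier : ∀ m → m < x + y → suc (pair x y) ∸ tri (suc m) ≢ 0
    above-earlier m m<s eq =
      n≮n (pair x y) (≤-trans (m∸n≡0⇒m≤n eq) (≤-trans (tri-mono-≤ m<s) (m≤m+n (tri (x + y)) y)))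

  unpair₂-decode : ∀ k → k ∸ tri (diagonal k) ≡ unpair₂ k
  unpair₂-decode k = subst (λ z → z ∸ tri (diagonal z) ≡ unpair₂ k) (pair-unpair k) (begin
    pair x y ∸ tri (diagonal (pair x y)) ≡⟨ cong (λ s → pair x y ∸ tri s) (diagonal-pair x y) ⟩
    tri (x + y) + y ∸ tri (x + y)         ≡⟨ m+n∸m≡n (tri (x + y)) y ⟩
    y                                     ∎)
    where x = unpair₁ k ; y = unpair₂ k

  unpair₁-decode : ∀ k → diagonal k ∸ unpair₂ k ≡ unpair₁ k
  unpair₁-decode k = begin
    diagonal k ∸ y ≡⟨ cong (_∸ y) (subst (λ z → diagonal z ≡ x + y) (pair-unpair k) (diagonal-pair x y)) ⟩
    x + y ∸ y      ≡⟨ m+n∸n≡m x y ⟩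
    x              ∎
    where x = unpair₁ k ; y = unpair₂ k

+-holds : ∀ m n → holds (m + n) ≡ holds m ∧ holds n
+-holds zero    n = refl
+-holds (suc m) n = refl

∸+∸-holds : ∀ m n → holds ((m ∸ n) + (n ∸ m)) ≡ (m ≡ᵇ n)
∸+∸-holds zero    zero    = refl
∸+∸-holds zero    (suc n) = refl
∸+∸-holds (suc m) zero    = refl
∸+∸-holds (suc m) (suc n) = ∸+∸-holds m n

toBool-fromBool : ∀ b → toBool (fromBool b) ≡ b
toBool-fromBool true  = refl
toBool-fromBool false = refl

fromBool-≡ᵇ1 : ∀ b → (fromBool b ≡ᵇ 1) ≡ b
fromBool-≡ᵇ1 true  = refl
fromBool-≡ᵇ1 false = refl

holds-fromBool : ∀ b → holds (fromBool b) ≡ not b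
holds-fromBool true  = refl
holds-fromBool false = refl

infixl 6 _+ᴾ_ _∸ᴾ_
infixr 6 _∧ᴾ_
infixr 7 _⊕ᴾ_
infix 8 _≡ᴾ_

sucᴾ : ∀ {Γ} → Prog Γ → Prog Γ
sucᴾ e = s4 s1 e

callᴾ : ∀ {Γ} → ar ι ∈ᵗ Γ → Prog (ι ∷ Γ)
callᴾ v = s6 (there v) s7

-- The combinators are used only through their evaluation lemmas; keeping them
-- opaque stops the type checker from unfolding eval on large programs.
opaque
  predᴾ : ∀ {Γ} → Prog Γ → Prog Γ
  predᴾ e = s4 (s5 (s2 0) (s6 (there here) s3)) e

  _+ᴾ_ : ∀ {Γ} → Prog Γ → Prog Γ → Prog Γ
  x +ᴾ y = s4 (s5 x s1) y

  _∸ᴾ_ : ∀ {Γ} → Prog Γ → Prog Γ → Prog Γ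
  x ∸ᴾ y = s4 (s5 x (predᴾ s3)) y

  triᴾ : ∀ {Γ} → Prog Γ → Prog Γ
  triᴾ x = s4 (s5 (s2 0) (s3 +ᴾ s6 (there here) s1)) x

  pairᴾ : ∀ {Γ} → Prog Γ → Prog Γ → Prog Γ
  pairᴾ x y = triᴾ (x +ᴾ y) +ᴾ y

  ifᴾ_then_else_ : ∀ {Γ} → Prog Γ → Prog Γ → Prog Γ → Prog Γ
  ifᴾ t then a else b = s4 (s5 a (weaken₂ b)) t

  bitᴾ : ∀ {Γ} → Prog Γ → Prog Γ
  bitᴾ t = ifᴾ t then s2 1 else s2 0

  _≡ᴾ_ : ∀ {Γ} → Prog Γ → Prog Γ → Prog Γ
  x ≡ᴾ y = (x ∸ᴾ y) +ᴾ (y ∸ᴾ x)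

  _⊕ᴾ_ : ∀ {Γ} → Prog Γ → Prog Γ → Prog Γ
  s ⊕ᴾ t = ifᴾ s then bitᴾ t else t

  diagonalᴾ : ∀ {Γ} → Prog Γ → Prog Γ
  diagonalᴾ k = oμ (sucᴾ (weaken k) ∸ᴾ triᴾ s1)

  unpair₂ᴾ : ∀ {Γ} → Prog Γ → Prog Γ
  unpair₂ᴾ k = k ∸ᴾ triᴾ (diagonalᴾ k)

  unpair₁ᴾ : ∀ {Γ} → Prog Γ → Prog Γ
  unpair₁ᴾ k = diagonalᴾ k ∸ᴾ unpair₂ᴾ k

  applyᴾ : ∀ {Γ} → ar (ar ι) ∈ᵗ Γ → Prog (ι ∷ Γ) → Prog Γ
  applyᴾ v body = s6 v (s8 (rename (lift (toFront v)) body))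

_∧ᴾ_ : ∀ {Γ} → Prog Γ → Prog Γ → Prog Γ
_∧ᴾ_ = _+ᴾ_

-- The bit of a test, read as a test, is its negation.
notᴾ : ∀ {Γ} → Prog Γ → Prog Γ
notᴾ = bitᴾ

module Evaluation (μ : (ℕ → ℕ) → ℕ) (μ-spec : IsFeferman μ)
                  (Θ : ((ℕ → ℕ) → ℕ) → List (ℕ → ℕ)) (Θ-ext : ExtΘ Θ) where
  open Eval μ Θ
  open Feferman μ μ-spec
  open Renaming μ Θ μ-ext Θ-ext

  opaque
    unfolding predᴾ

    eval-+ᴾ : ∀ {Γ} (x y : Prog Γ) (ρ : Env Γ) → eval (x +ᴾ y) ρ ≡ eval x ρ + eval y ρ
    eval-+ᴾ x y ρ = go (eval y ρ)
      where
      go : ∀ m → evalRec x s1 ρ m ≡ eval x ρ + m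
      go zero    = sym (+-identityʳ _)
      go (suc m) = trans (cong suc (go m)) (sym (+-suc _ m))

    eval-predᴾ : ∀ {Γ} (e : Prog Γ) (ρ : Env Γ) → eval (predᴾ e) ρ ≡ pred (eval e ρ)
    eval-predᴾ e ρ with eval e ρ
    ... | zero  = refl
    ... | suc _ = refl

    eval-∸ᴾ : ∀ {Γ} (x y : Prog Γ) (ρ : Env Γ) → eval (x ∸ᴾ y) ρ ≡ eval x ρ ∸ eval y ρ
    eval-∸ᴾ x y ρ = go (eval y ρ)
      where
      go : ∀ m → evalRec x (predᴾ s3) ρ m ≡ eval x ρ ∸ m
      go zero    = refl
      go (suc m) = begin
        evalRec x (predᴾ s3) ρ (suc m) ≡⟨ eval-predᴾ s3 (evalRec x (predᴾ s3) ρ m ∷ m ∷ ρ) ⟩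
        pred (evalRec x (predᴾ s3) ρ m) ≡⟨ cong pred (go m) ⟩
        pred (eval x ρ ∸ m)             ≡⟨ pred[m∸n]≡m∸[1+n] (eval x ρ) m ⟩
        eval x ρ ∸ suc m                ∎

    eval-triᴾ : ∀ {Γ} (x : Prog Γ) (ρ : Env Γ) → eval (triᴾ x) ρ ≡ tri (eval x ρ)
    eval-triᴾ {Γ} x ρ = go (eval x ρ)
      where
      step : Prog (ι ∷ ι ∷ Γ)
      step = s3 +ᴾ s6 (there here) s1
      go : ∀ m → evalRec (s2 0) step ρ m ≡ tri m
      go zero    = refl
      go (suc m) = trans (eval-+ᴾ s3 (s6 (there here) s1) (evalRec (s2 0) step ρ m ∷ m ∷ ρ))
                         (cong (_+ suc m) (go m))

    eval-pairᴾ : ∀ {Γ} (x y : Prog Γ) (ρ : Env Γ) → eval (pairᴾ x y) ρ ≡ pair (eval x ρ) (eval y ρ)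
    eval-pairᴾ x y ρ = begin
      eval (pairᴾ x y) ρ                  ≡⟨ eval-+ᴾ (triᴾ (x +ᴾ y)) y ρ ⟩
      eval (triᴾ (x +ᴾ y)) ρ + eval y ρ   ≡⟨ cong (_+ eval y ρ) (eval-triᴾ (x +ᴾ y) ρ) ⟩
      tri (eval (x +ᴾ y) ρ) + eval y ρ    ≡⟨ cong (λ s → tri s + eval y ρ) (eval-+ᴾ x y ρ) ⟩
      pair (eval x ρ) (eval y ρ)          ∎

    eval-ifᴾ : ∀ {Γ} (t a b : Prog Γ) (ρ : Env Γ) → ExtensionalEnv ρ →
               eval (ifᴾ t then a else b) ρ ≡ (if holds (eval t ρ) then eval a ρ else eval b ρ)
    eval-ifᴾ t a b ρ ex with eval t ρ
    ... | zero  = refl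
    ... | suc n = eval-weaken₂ b (tt , tt , ex)

    holds-∧ᴾ : ∀ {Γ} (s t : Prog Γ) (ρ : Env Γ) → holds (eval (s ∧ᴾ t) ρ) ≡ holds (eval s ρ) ∧ holds (eval t ρ)
    holds-∧ᴾ s t ρ = trans (cong holds (eval-+ᴾ s t ρ)) (+-holds (eval s ρ) (eval t ρ))

    eval-bitᴾ : ∀ {Γ} (t : Prog Γ) (ρ : Env Γ) → ExtensionalEnv ρ → eval (bitᴾ t) ρ ≡ fromBool (holds (eval t ρ))
    eval-bitᴾ t ρ ex with holds (eval t ρ) | eval-ifᴾ t (s2 1) (s2 0) ρ ex
    ... | true  | eq = eq
    ... | false | eq = eq

    holds-notᴾ : ∀ {Γ} (t : Prog Γ) (ρ : Env Γ) → ExtensionalEnv ρ → holds (eval (notᴾ t) ρ) ≡ not (holds (eval t ρ))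
    holds-notᴾ t ρ ex = trans (cong holds (eval-bitᴾ t ρ ex)) (holds-fromBool (holds (eval t ρ)))

    holds-⊕ᴾ : ∀ {Γ} (s t : Prog Γ) (ρ : Env Γ) → ExtensionalEnv ρ →
               holds (eval (s ⊕ᴾ t) ρ) ≡ holds (eval s ρ) xor holds (eval t ρ)
    holds-⊕ᴾ s t ρ ex with holds (eval s ρ) | eval-ifᴾ s (notᴾ t) t ρ ex
    ... | true  | eq = trans (cong holds eq) (holds-notᴾ t ρ ex)
    ... | false | eq = cong holds eq

    holds-≡ᴾ : ∀ {Γ} (x y : Prog Γ) (ρ : Env Γ) → holds (eval (x ≡ᴾ y) ρ) ≡ (eval x ρ ≡ᵇ eval y ρ)
    holds-≡ᴾ x y ρ = begin
      holds (eval (x ≡ᴾ y) ρ)                                   ≡⟨ cong holds (eval-+ᴾ (x ∸ᴾ y) (y ∸ᴾ x) ρ) ⟩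
      holds (eval (x ∸ᴾ y) ρ + eval (y ∸ᴾ x) ρ)                 ≡⟨ cong₂ (λ u v → holds (u + v)) (eval-∸ᴾ x y ρ) (eval-∸ᴾ y x ρ) ⟩
      holds ((eval x ρ ∸ eval y ρ) + (eval y ρ ∸ eval x ρ))     ≡⟨ ∸+∸-holds (eval x ρ) (eval y ρ) ⟩
      (eval x ρ ≡ᵇ eval y ρ)                                    ∎

    eval-diagonalᴾ : ∀ {Γ} (k : Prog Γ) (ρ : Env Γ) → ExtensionalEnv ρ → eval (diagonalᴾ k) ρ ≡ diagonal (eval k ρ)
    eval-diagonalᴾ k ρ ex = μ-ext _ _ λ s → begin
      eval (sucᴾ (weaken k) ∸ᴾ triᴾ s1) (s ∷ ρ)                 ≡⟨ eval-∸ᴾ (sucᴾ (weaken k)) (triᴾ s1) (s ∷ ρ) ⟩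
      suc (eval (weaken k) (s ∷ ρ)) ∸ eval (triᴾ s1) (s ∷ ρ)    ≡⟨ cong₂ (λ u v → suc u ∸ v) (eval-weaken k (tt , ex)) (eval-triᴾ s1 (s ∷ ρ)) ⟩
      suc (eval k ρ) ∸ tri (suc s)                              ∎

    eval-unpair₂ᴾ : ∀ {Γ} (k : Prog Γ) (ρ : Env Γ) → ExtensionalEnv ρ → eval (unpair₂ᴾ k) ρ ≡ unpair₂ (eval k ρ)
    eval-unpair₂ᴾ k ρ ex = begin
      eval (unpair₂ᴾ k) ρ                           ≡⟨ eval-∸ᴾ k (triᴾ (diagonalᴾ k)) ρ ⟩
      eval k ρ ∸ eval (triᴾ (diagonalᴾ k)) ρ        ≡⟨ cong (eval k ρ ∸_) (eval-triᴾ (diagonalᴾ k) ρ) ⟩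
      eval k ρ ∸ tri (eval (diagonalᴾ k) ρ)         ≡⟨ cong (λ d → eval k ρ ∸ tri d) (eval-diagonalᴾ k ρ ex) ⟩
      eval k ρ ∸ tri (diagonal (eval k ρ))          ≡⟨ unpair₂-decode (eval k ρ) ⟩
      unpair₂ (eval k ρ)                            ∎

    eval-unpair₁ᴾ : ∀ {Γ} (k : Prog Γ) (ρ : Env Γ) → ExtensionalEnv ρ → eval (unpair₁ᴾ k) ρ ≡ unpair₁ (eval k ρ)
    eval-unpair₁ᴾ k ρ ex = begin
      eval (unpair₁ᴾ k) ρ                               ≡⟨ eval-∸ᴾ (diagonalᴾ k) (unpair₂ᴾ k) ρ ⟩
      eval (diagonalᴾ k) ρ ∸ eval (unpair₂ᴾ k) ρ        ≡⟨ cong₂ _∸_ (eval-diagonalᴾ k ρ ex) (eval-unpair₂ᴾ k ρ ex) ⟩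
      diagonal (eval k ρ) ∸ unpair₂ (eval k ρ)          ≡⟨ unpair₁-decode (eval k ρ) ⟩
      unpair₁ (eval k ρ)                                ∎

    eval-applyᴾ : ∀ {Γ} (v : ar (ar ι) ∈ᵗ Γ) (body : Prog (ι ∷ Γ)) (ρ : Env Γ) → ExtensionalEnv ρ →
                  eval (applyᴾ v body) ρ ≡ get v ρ (λ y → eval body (y ∷ ρ))
    eval-applyᴾ v body ρ ex = extensional-get ex v _ _ λ y →
      eval-rename (lift (toFront v)) body (tt , extensional-get ex v , extensional-drop ex v) (along y)
      where
      along : ∀ (y : ℕ) → Along (lift (toFront v)) (y ∷ ρ) (y ∷ get v ρ ∷ drop v ρ)
      along y here      = refl
      along y (there w) = get-toFront v w ρ

record Handles (Γ : List Ty) : Set where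
  field
    fᵛ : ar ι ∈ᵗ Γ
    gᴾ : Prog (ι ∷ Γ)
    Fᵛ : ar (ar ι) ∈ᵗ Γ
open Handles

shift : ∀ {σ Γ} → Handles Γ → Handles (σ ∷ Γ)
shift H = record { fᵛ = there (fᵛ H) ; gᴾ = rename (lift there) (gᴾ H) ; Fᵛ = there (Fᵛ H) }

module _ {Γ} (H : Handles Γ) where
  fAtᴾ gAtᴾ : Prog Γ → Prog Γ
  fAtᴾ x = s4 (callᴾ (fᵛ H)) x
  gAtᴾ x = s4 (gᴾ H) x

  lessᴾ : Prog Γ → Prog Γ → Prog Γ
  lessᴾ d a = fAtᴾ (pairᴾ d a) ∧ᴾ notᴾ (d ≡ᴾ a)

belowᴾ : ∀ {Γ} → Handles Γ → Prog Γ → Prog Γ → Prog Γ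
belowᴾ H a k = (gAtᴾ H k ≡ᴾ s2 1) ∧ᴾ lessᴾ H (unpair₂ᴾ k) a

-- F is available as encF F, whose argument lists b followed by the bits of below a g.
Fbelowᴾ : ∀ {Γ} → Handles Γ → Prog Γ → Prog Γ → Prog Γ
Fbelowᴾ H a b = applyᴾ (Fᵛ H) (ifᴾ s3 then weaken b else bitᴾ (belowᴾ (shift H) (weaken a) (predᴾ s3))) ≡ᴾ s2 1

failsᴾ : ∀ {Γ} → Handles Γ → Prog Γ → Prog Γ
failsᴾ H n = fAtᴾ H (pairᴾ d d) ∧ᴾ gAtᴾ H n ≡ᴾ s2 1 ⊕ᴾ Fbelowᴾ H d (unpair₁ᴾ n)
  where d = unpair₂ᴾ n

failsBelowᴾ : ∀ {Γ} → Handles Γ → Prog Γ → Prog Γ → Prog Γ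
failsBelowᴾ H a m = failsᴾ H m ∧ᴾ lessᴾ H (unpair₂ᴾ m) a

failureBelowᴾ : ∀ {Γ} → Handles Γ → Prog Γ → Prog Γ
failureBelowᴾ H a = failsBelowᴾ H a (oμ (failsBelowᴾ (shift H) (weaken a) s3))

minimalFailureᴾ : ∀ {Γ} → Handles Γ → Prog Γ → Prog Γ
minimalFailureᴾ H n = failsᴾ H n ∧ᴾ notᴾ (failureBelowᴾ H (unpair₂ᴾ n))

firstMinimalFailureᴾ : ∀ {Γ} → Handles Γ → Prog Γ
firstMinimalFailureᴾ H = oμ (minimalFailureᴾ (shift H) s3)

Gᴾ : ∀ {Γ} → Handles Γ → Prog Γ
Gᴾ H = ifᴾ minimalFailureᴾ H m then sucᴾ m else s2 0
  where m = firstMinimalFailureᴾ H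

failureFreeᴾ : ∀ {Γ} → Handles Γ → Prog Γ
failureFreeᴾ H = notᴾ (failsᴾ H (oμ (failsᴾ (shift H) s3)))

-- In Gᴴ the candidate g is the extra first argument; in Tᴴ it is the i-th entry of Θ(G).
Gᴴ : Handles (ar ι ∷ CtxT)
Gᴴ = record { fᵛ = there here ; gᴾ = callᴾ here ; Fᵛ = there (there here) }

Tᴴ : Handles (ι ∷ CtxT)
Tᴴ = record
  { fᵛ = there here
  ; gᴾ = oΘelt (rename (lift (λ w → there (there w))) (Gᴾ Gᴴ)) (s6 (there here) s3) s3
  ; Fᵛ = there (there here)
  }

Tᴾ : Prog CtxT
Tᴾ = oΘelt (Gᴾ Gᴴ) (oμ (failureFreeᴾ Tᴴ)) (s6 (there (there here)) s3)

_<ᵇ[_]_ : ℕ → (ℕ → ℕ) → ℕ → Bool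
d <ᵇ[ f ] a = (f (pair d a) ≡ᵇ 0) ∧ not (d ≡ᵇ a)

module Candidates (μ : (ℕ → ℕ) → ℕ) (μ-spec : IsFeferman μ)
                  (f : ℕ → ℕ) (F : (ℕ → Bool) → (ℕ → Bool)) where
  open Feferman μ μ-spec using (search)

  fails : (ℕ → ℕ) → ℕ → Bool
  fails g n = (f (pair (unpair₂ n) (unpair₂ n)) ≡ᵇ 0) ∧ ((g n ≡ᵇ 1) xor F (below f (unpair₂ n) g) (unpair₁ n))

  failsBelow : (ℕ → ℕ) → ℕ → ℕ → Bool
  failsBelow g a m = fails g m ∧ (unpair₂ m <ᵇ[ f ] a)

  failureBelow : (ℕ → ℕ) → ℕ → Bool
  failureBelow g a = failsBelow g a (search (failsBelow g a))

  minimalFailure : (ℕ → ℕ) → ℕ → Bool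
  minimalFailure g n = fails g n ∧ not (failureBelow g (unpair₂ n))

  firstMinimalFailure : (ℕ → ℕ) → ℕ
  firstMinimalFailure g = search (minimalFailure g)

  G : (ℕ → ℕ) → ℕ
  G g = if minimalFailure g (firstMinimalFailure g) then suc (firstMinimalFailure g) else 0

  failureFree : (ℕ → ℕ) → Bool
  failureFree g = not (fails g (search (fails g)))

module Correctness (μ : (ℕ → ℕ) → ℕ) (μ-spec : IsFeferman μ)
                   (Θ : ((ℕ → ℕ) → ℕ) → List (ℕ → ℕ)) (Θ-ext : ExtΘ Θ)
                   (f : ℕ → ℕ) (F : (ℕ → Bool) → (ℕ → Bool)) (F-ext : ExtF F) where
  open Eval μ Θ
  open Feferman μ μ-spec
  open Renaming μ Θ μ-ext Θ-ext
  open Evaluation μ μ-spec Θ Θ-ext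
  open Candidates μ μ-spec f F

  record Interprets {Γ} (H : Handles Γ) (ρ : Env Γ) (g : ℕ → ℕ) : Set where
    field
      extensional : ExtensionalEnv ρ
      f-at        : get (fᵛ H) ρ ≡ f
      F-at        : get (Fᵛ H) ρ ≡ encF F
      g-at        : ∀ x → eval (gᴾ H) (x ∷ ρ) ≡ g x
  open Interprets

  interprets-shift : ∀ {σ Γ} {H : Handles Γ} {ρ g} {x : ⟦ σ ⟧} →
                     Interprets H ρ g → Extensional σ x → Interprets (shift H) (x ∷ ρ) g
  interprets-shift {H = H} I ex = record
    { extensional = ex , extensional I
    ; f-at        = f-at I
    ; F-at        = F-at I
    ; g-at        = λ y → trans (eval-rename (lift there) (gᴾ H) (tt , ex , extensional I) (along-lift y λ _ → refl))
                                (g-at I y)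
    }

  module _ {Γ} {H : Handles Γ} {ρ : Env Γ} {g : ℕ → ℕ} (I : Interprets H ρ g) where
    private ex = extensional I

    eval-fAtᴾ : ∀ x → eval (fAtᴾ H x) ρ ≡ f (eval x ρ)
    eval-fAtᴾ x = cong (λ h → h (eval x ρ)) (f-at I)

    eval-gAtᴾ : ∀ x → eval (gAtᴾ H x) ρ ≡ g (eval x ρ)
    eval-gAtᴾ x = g-at I (eval x ρ)

    holds-lessᴾ : ∀ d a → holds (eval (lessᴾ H d a) ρ) ≡ eval d ρ <ᵇ[ f ] eval a ρ
    holds-lessᴾ d a = begin
      holds (eval (lessᴾ H d a) ρ)
        ≡⟨ holds-∧ᴾ (fAtᴾ H (pairᴾ d a)) (notᴾ (d ≡ᴾ a)) ρ ⟩
      holds (eval (fAtᴾ H (pairᴾ d a)) ρ) ∧ holds (eval (notᴾ (d ≡ᴾ a)) ρ)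
        ≡⟨ cong₂ _∧_ (cong holds (trans (eval-fAtᴾ (pairᴾ d a)) (cong f (eval-pairᴾ d a ρ))))
                     (trans (holds-notᴾ (d ≡ᴾ a) ρ ex) (cong not (holds-≡ᴾ d a ρ))) ⟩
      eval d ρ <ᵇ[ f ] eval a ρ ∎

    holds-belowᴾ : ∀ a k → holds (eval (belowᴾ H a k) ρ) ≡ below f (eval a ρ) g (eval k ρ)
    holds-belowᴾ a k = begin
      holds (eval (belowᴾ H a k) ρ)
        ≡⟨ holds-∧ᴾ (gAtᴾ H k ≡ᴾ s2 1) (lessᴾ H (unpair₂ᴾ k) a) ρ ⟩
      holds (eval (gAtᴾ H k ≡ᴾ s2 1) ρ) ∧ holds (eval (lessᴾ H (unpair₂ᴾ k) a) ρ)
        ≡⟨ cong₂ _∧_ (trans (holds-≡ᴾ (gAtᴾ H k) (s2 1) ρ) (cong (_≡ᵇ 1) (eval-gAtᴾ k)))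
                     (trans (holds-lessᴾ (unpair₂ᴾ k) a) (cong (_<ᵇ[ f ] eval a ρ) (eval-unpair₂ᴾ k ρ ex))) ⟩
      below f (eval a ρ) g (eval k ρ) ∎

  module _ {Γ} {H : Handles Γ} {ρ : Env Γ} {g : ℕ → ℕ} (I : Interprets H ρ g) where
    private ex = extensional I

    holds-Fbelowᴾ : ∀ a b → holds (eval (Fbelowᴾ H a b) ρ) ≡ F (below f (eval a ρ) g) (eval b ρ)
    holds-Fbelowᴾ a b = begin
      holds (eval (Fbelowᴾ H a b) ρ)                          ≡⟨ holds-≡ᴾ (applyᴾ (Fᵛ H) body) (s2 1) ρ ⟩
      (eval (applyᴾ (Fᵛ H) body) ρ ≡ᵇ 1)                      ≡⟨ cong (_≡ᵇ 1) (eval-applyᴾ (Fᵛ H) body ρ ex) ⟩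
      (get (Fᵛ H) ρ (λ y → eval body (y ∷ ρ)) ≡ᵇ 1)          ≡⟨ cong (λ Φ → Φ (λ y → eval body (y ∷ ρ)) ≡ᵇ 1) (F-at I) ⟩
      (fromBool (F (λ k → toBool (eval body (suc k ∷ ρ))) (eval body (0 ∷ ρ))) ≡ᵇ 1)
        ≡⟨ fromBool-≡ᵇ1 _ ⟩
      F (λ k → toBool (eval body (suc k ∷ ρ))) (eval body (0 ∷ ρ))
        ≡⟨ trans (F-ext (λ k → toBool (eval body (suc k ∷ ρ))) (below f (eval a ρ) g) bits (eval body (0 ∷ ρ)))
                 (cong (F (below f (eval a ρ) g)) head) ⟩
      F (below f (eval a ρ) g) (eval b ρ)                     ∎
      where
      belowTest = belowᴾ (shift H) (weaken a) (predᴾ s3)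
      body = ifᴾ s3 then weaken b else bitᴾ belowTest
      head : eval body (0 ∷ ρ) ≡ eval b ρ
      head = trans (eval-ifᴾ s3 (weaken b) (bitᴾ belowTest) (0 ∷ ρ) (tt , ex)) (eval-weaken b (tt , ex))
      bits : ∀ k → toBool (eval body (suc k ∷ ρ)) ≡ below f (eval a ρ) g k
      bits k = begin
        toBool (eval body (suc k ∷ ρ))
          ≡⟨ cong toBool (trans (eval-ifᴾ s3 (weaken b) (bitᴾ belowTest) (suc k ∷ ρ) (tt , ex))
                                (eval-bitᴾ belowTest (suc k ∷ ρ) (tt , ex))) ⟩
        toBool (fromBool (holds (eval belowTest (suc k ∷ ρ))))
          ≡⟨ toBool-fromBool _ ⟩
        holds (eval belowTest (suc k ∷ ρ))
          ≡⟨ holds-belowᴾ (interprets-shift I tt) (weaken a) (predᴾ s3) ⟩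
        below f (eval (weaken a) (suc k ∷ ρ)) g (eval (predᴾ s3) (suc k ∷ ρ))
          ≡⟨ cong₂ (λ a' k' → below f a' g k') (eval-weaken a (tt , ex)) (eval-predᴾ s3 (suc k ∷ ρ)) ⟩
        below f (eval a ρ) g k ∎

    holds-failsᴾ : ∀ n → holds (eval (failsᴾ H n) ρ) ≡ fails g (eval n ρ)
    holds-failsᴾ n = begin
      holds (eval (failsᴾ H n) ρ)
        ≡⟨ holds-∧ᴾ (fAtᴾ H (pairᴾ d d)) (gAtᴾ H n ≡ᴾ s2 1 ⊕ᴾ Fbelowᴾ H d c) ρ ⟩
      holds (eval (fAtᴾ H (pairᴾ d d)) ρ) ∧ holds (eval (gAtᴾ H n ≡ᴾ s2 1 ⊕ᴾ Fbelowᴾ H d c) ρ)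
        ≡⟨ cong₂ _∧_ field-test (holds-⊕ᴾ (gAtᴾ H n ≡ᴾ s2 1) (Fbelowᴾ H d c) ρ ex) ⟩
      (f (pair D D) ≡ᵇ 0) ∧ (holds (eval (gAtᴾ H n ≡ᴾ s2 1) ρ) xor holds (eval (Fbelowᴾ H d c) ρ))
        ≡⟨ cong (λ u → (f (pair D D) ≡ᵇ 0) ∧ u)
                (cong₂ _xor_ (trans (holds-≡ᴾ (gAtᴾ H n) (s2 1) ρ) (cong (_≡ᵇ 1) (eval-gAtᴾ I n)))
                             (trans (holds-Fbelowᴾ d c) (cong₂ (λ a b → F (below f a g) b) (eval-unpair₂ᴾ n ρ ex) (eval-unpair₁ᴾ n ρ ex)))) ⟩
      fails g (eval n ρ) ∎
      where
      d = unpair₂ᴾ n ; c = unpair₁ᴾ n ; D = unpair₂ (eval n ρ)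
      field-test : holds (eval (fAtᴾ H (pairᴾ d d)) ρ) ≡ (f (pair D D) ≡ᵇ 0)
      field-test = cong holds (trans (eval-fAtᴾ I (pairᴾ d d))
                                     (cong f (trans (eval-pairᴾ d d ρ) (cong₂ pair (eval-unpair₂ᴾ n ρ ex) (eval-unpair₂ᴾ n ρ ex)))))

    holds-failsBelowᴾ : ∀ a m → holds (eval (failsBelowᴾ H a m) ρ) ≡ failsBelow g (eval a ρ) (eval m ρ)
    holds-failsBelowᴾ a m = trans (holds-∧ᴾ (failsᴾ H m) (lessᴾ H (unpair₂ᴾ m) a) ρ)
      (cong₂ _∧_ (holds-failsᴾ m) (trans (holds-lessᴾ I (unpair₂ᴾ m) a) (cong (_<ᵇ[ f ] eval a ρ) (eval-unpair₂ᴾ m ρ ex))))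

  module _ {Γ} {H : Handles Γ} {ρ : Env Γ} {g : ℕ → ℕ} (I : Interprets H ρ g) where
    private ex = extensional I

    holds-failureBelowᴾ : ∀ a → holds (eval (failureBelowᴾ H a) ρ) ≡ failureBelow g (eval a ρ)
    holds-failureBelowᴾ a = trans (holds-failsBelowᴾ I a first) (cong (failsBelow g (eval a ρ)) eval-first)
      where
      first = oμ (failsBelowᴾ (shift H) (weaken a) s3)
      eval-first : eval first ρ ≡ search (failsBelow g (eval a ρ))
      eval-first = μ-search (λ m → eval (failsBelowᴾ (shift H) (weaken a) s3) (m ∷ ρ)) (failsBelow g (eval a ρ)) λ m →
        trans (holds-failsBelowᴾ (interprets-shift I tt) (weaken a) s3)
              (cong (λ a' → failsBelow g a' m) (eval-weaken a (tt , ex)))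

    holds-minimalFailureᴾ : ∀ n → holds (eval (minimalFailureᴾ H n) ρ) ≡ minimalFailure g (eval n ρ)
    holds-minimalFailureᴾ n = trans (holds-∧ᴾ (failsᴾ H n) (notᴾ (failureBelowᴾ H (unpair₂ᴾ n))) ρ)
      (cong₂ _∧_ (holds-failsᴾ I n)
                 (trans (holds-notᴾ (failureBelowᴾ H (unpair₂ᴾ n)) ρ ex)
                        (cong not (trans (holds-failureBelowᴾ (unpair₂ᴾ n)) (cong (failureBelow g) (eval-unpair₂ᴾ n ρ ex))))))

  module _ {Γ} {H : Handles Γ} {ρ : Env Γ} {g : ℕ → ℕ} (I : Interprets H ρ g) where
    private ex = extensional I

    eval-firstMinimalFailureᴾ : eval (firstMinimalFailureᴾ H) ρ ≡ firstMinimalFailure g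
    eval-firstMinimalFailureᴾ =
      μ-search (λ m → eval (minimalFailureᴾ (shift H) s3) (m ∷ ρ)) (minimalFailure g) λ m →
        holds-minimalFailureᴾ (interprets-shift I tt) s3

    eval-Gᴾ : eval (Gᴾ H) ρ ≡ G g
    eval-Gᴾ = trans (eval-ifᴾ (minimalFailureᴾ H m) (sucᴾ m) (s2 0) ρ ex)
      (cong₂ (λ b v → if b then suc v else 0)
             (trans (holds-minimalFailureᴾ I m) (cong (minimalFailure g) eval-firstMinimalFailureᴾ))
             eval-firstMinimalFailureᴾ)
      where m = firstMinimalFailureᴾ H

    holds-failureFreeᴾ : holds (eval (failureFreeᴾ H) ρ) ≡ failureFree g
    holds-failureFreeᴾ = trans (holds-notᴾ (failsᴾ H first) ρ ex)
      (cong not (trans (holds-failsᴾ I first) (cong (fails g) eval-first)))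
      where
      first = oμ (failsᴾ (shift H) s3)
      eval-first : eval first ρ ≡ search (fails g)
      eval-first = μ-search (λ m → eval (failsᴾ (shift H) s3) (m ∷ ρ)) (fails g) λ m →
        holds-failsᴾ (interprets-shift I tt) s3

  encF-extensional : Extensional (ar (ar ι)) (encF F)
  encF-extensional h h' h≗h' = cong fromBool (begin
    F (λ k → toBool (h (suc k))) (h 0)   ≡⟨ F-ext _ _ (λ k → cong toBool (h≗h' (suc k))) (h 0) ⟩
    F (λ k → toBool (h' (suc k))) (h 0)  ≡⟨ cong (F (λ k → toBool (h' (suc k)))) (h≗h' 0) ⟩
    F (λ k → toBool (h' (suc k))) (h' 0) ∎)

  module _ (n : ℕ) where
    env : Env CtxT
    env = f ∷ encF F ∷ n ∷ []

    env-extensional : ExtensionalEnv env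
    env-extensional = tt , encF-extensional , tt , tt

    Gᴴ-interprets : ∀ h → Interprets Gᴴ (h ∷ env) h
    Gᴴ-interprets h = record { extensional = tt , env-extensional ; f-at = refl ; F-at = refl ; g-at = λ _ → refl }

    Θ-eval-Gᴾ : Θ (λ h → eval (Gᴾ Gᴴ) (h ∷ env)) ≡ Θ G
    Θ-eval-Gᴾ = Θ-ext _ _ λ h → eval-Gᴾ (Gᴴ-interprets h)

    Tᴴ-interprets : ∀ i → Interprets Tᴴ (i ∷ env) (nth (Θ G) i)
    Tᴴ-interprets i = record
      { extensional = tt , env-extensional
      ; f-at        = refl
      ; F-at        = refl
      ; g-at        = λ x → cong (λ L → nth L i x) (trans (Θ-ext _ _ λ h →
          eval-rename (lift (λ w → there (there w))) (Gᴾ Gᴴ) (tt , tt , tt , env-extensional) (along-lift h λ _ → refl))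
          Θ-eval-Gᴾ)
      }

  chosen : ℕ → ℕ
  chosen = nth (Θ G) (search (λ i → failureFree (nth (Θ G) i)))

  eval-Tᴾ : ∀ n → Tfun Tᴾ μ Θ f F n ≡ chosen n
  eval-Tᴾ n = cong₂ (λ L i → nth L i n) (Θ-eval-Gᴾ n)
    (μ-search (λ i → eval (failureFreeᴾ Tᴴ) (i ∷ env n)) (λ i → failureFree (nth (Θ G) i)) λ i →
       holds-failureFreeᴾ (Tᴴ-interprets n i))

Coherent : (ℕ → ℕ) → ((ℕ → Bool) → (ℕ → Bool)) → (ℕ → ℕ) → ℕ → Set
Coherent f F g n = (g n ≡ᵇ 1) ≡ F (below f (unpair₂ n) g) (unpair₁ n)

<ᵇ-reflects : ∀ f d a → Reflects (d <[ f ] a) (d <ᵇ[ f ] a)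
<ᵇ-reflects f d a = ≡ᵇ-reflects (f (pair d a)) 0 ×-reflects ¬-reflects (≡ᵇ-reflects d a)
  where
  ≡ᵇ-reflects : ∀ m n → Reflects (m ≡ n) (m ≡ᵇ n)
  ≡ᵇ-reflects m n = fromEquivalence (≡ᵇ⇒≡ m n) (≡⇒≡ᵇ m n)

reflects-true : ∀ {P : Set} {b} → Reflects P b → P → b ≡ true
reflects-true (ofʸ _)  _ = refl
reflects-true (ofⁿ ¬p) p = ⊥-elim (¬p p)

∧-reflects-cong : ∀ {P : Set} {b} → Reflects P b → ∀ x y → (P → x ≡ y) → x ∧ b ≡ y ∧ b
∧-reflects-cong (ofʸ p) x y eq = cong (_∧ true) (eq p)
∧-reflects-cong (ofⁿ _) x y eq = trans (∧-zeroʳ x) (sym (∧-zeroʳ y))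

below-cong : ∀ f a (g h : ℕ → ℕ) → (∀ k → unpair₂ k <[ f ] a → (g k ≡ᵇ 1) ≡ (h k ≡ᵇ 1)) →
             ∀ k → below f a g k ≡ below f a h k
below-cong f a g h agree k = ∧-reflects-cong (<ᵇ-reflects f (unpair₂ k) a) (g k ≡ᵇ 1) (h k ≡ᵇ 1) (agree k)

guard : ∀ {P : Set} {b} → Reflects P b → (P → Bool) → Bool
guard (ofʸ p) x = x p
guard (ofⁿ _) x = false

guard-cong : ∀ {P : Set} {b} (r : Reflects P b) {x y : P → Bool} → (∀ p → x p ≡ y p) → guard r x ≡ guard r y
guard-cong (ofʸ p) eq = eq p
guard-cong (ofⁿ _) eq = refl

guard-∧ : ∀ {P : Set} {b} (r : Reflects P b) {x : P → Bool} {y} → (∀ p → x p ≡ y) → guard r x ≡ y ∧ b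
guard-∧ (ofʸ p) eq = trans (eq p) (sym (∧-identityʳ _))
guard-∧ (ofⁿ _) eq = sym (∧-zeroʳ _)

module Solution (f : ℕ → ℕ) (wf : WellFounded (λ x y → x <[ f ] y))
                (F : (ℕ → Bool) → (ℕ → Bool)) (F-ext : ExtF F) where

  column : ∀ a → Acc (λ x y → x <[ f ] y) a → ℕ → Bool
  column a (acc rs) = F λ k → guard (<ᵇ-reflects f (unpair₂ k) a) λ d<a → column (unpair₂ k) (rs d<a) (unpair₁ k)

  column-irrelevant : ∀ a (p q : Acc (λ x y → x <[ f ] y) a) c → column a p c ≡ column a q c
  column-irrelevant a (acc rs) (acc rs') = F-ext _ _ λ k →
    guard-cong (<ᵇ-reflects f (unpair₂ k) a) λ d<a → column-irrelevant (unpair₂ k) (rs d<a) (rs' d<a) (unpair₁ k)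

  Xᵇ : ℕ → Bool
  Xᵇ k = column (unpair₂ k) (wf (unpair₂ k)) (unpair₁ k)

  X : ℕ → ℕ
  X k = fromBool (Xᵇ k)

  X-binary : Binary X
  X-binary k with Xᵇ k
  ... | true  = ≤-refl
  ... | false = z≤n

  column-unfold : ∀ a (p : Acc (λ x y → x <[ f ] y) a) c → column a p c ≡ F (below f a X) c
  column-unfold a (acc rs) = F-ext _ _ λ k →
    guard-∧ (<ᵇ-reflects f (unpair₂ k) a) λ d<a →
      trans (column-irrelevant (unpair₂ k) (rs d<a) (wf (unpair₂ k)) (unpair₁ k)) (sym (fromBool-≡ᵇ1 (Xᵇ k)))

  X-coherent : ∀ k → Coherent f F X k
  X-coherent k = trans (fromBool-≡ᵇ1 (Xᵇ k)) (column-unfold (unpair₂ k) (wf (unpair₂ k)) (unpair₁ k))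

∧-true : ∀ x y → x ∧ y ≡ true → x ≡ true × y ≡ true
∧-true true true _ = refl , refl

not-true : ∀ x → not x ≡ true → x ≡ false
not-true false _ = refl

xor-false⇒≡ : ∀ x y → x xor y ≡ false → x ≡ y
xor-false⇒≡ true  true  _ = refl
xor-false⇒≡ false false _ = refl

xor-true⇒≢ : ∀ x y → x xor y ≡ true → x ≢ y
xor-true⇒≢ true  false _ ()
xor-true⇒≢ false true  _ ()

reflects-sound : ∀ {P : Set} {b} → Reflects P b → b ≡ true → P
reflects-sound (ofʸ p) _ = p

module Analysis (μ : (ℕ → ℕ) → ℕ) (μ-spec : IsFeferman μ)
                (f : ℕ → ℕ) (wo : IsWellOrdering f)
                (F : (ℕ → Bool) → (ℕ → Bool)) (F-ext : ExtF F) where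
  open Feferman μ μ-spec
  open Candidates μ μ-spec f F

  private
    field-of : ∀ x y → x ≤[ f ] y → Field f x × Field f y
    field-of = proj₁ wo
    antisym : ∀ x y → x ≤[ f ] y → y ≤[ f ] x → x ≡ y
    antisym = proj₁ (proj₂ wo)
    ≤-trans′ : ∀ x y z → x ≤[ f ] y → y ≤[ f ] z → x ≤[ f ] z
    ≤-trans′ = proj₁ (proj₂ (proj₂ wo))
    wf : WellFounded (λ x y → x <[ f ] y)
    wf = proj₂ (proj₂ (proj₂ (proj₂ wo)))

  open Solution f wf F F-ext public

  <-trans′ : ∀ {x y z} → x <[ f ] y → y <[ f ] z → x <[ f ] z
  <-trans′ {x} {y} {z} (x≤y , _) (y≤z , y≢z) =
    ≤-trans′ x y z x≤y y≤z , λ x≡z → y≢z (antisym y z y≤z (subst (_≤[ f ] y) x≡z x≤y))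

  fails-false⇒coherent : ∀ g n → Field f (unpair₂ n) → fails g n ≡ false → Coherent f F g n
  fails-false⇒coherent g n d∈f eq = xor-false⇒≡ (g n ≡ᵇ 1) recursion (subst (λ u → (u ≡ᵇ 0) ∧ ((g n ≡ᵇ 1) xor recursion) ≡ false) d∈f eq)
    where recursion = F (below f (unpair₂ n) g) (unpair₁ n)

  fails-true⇒incoherent : ∀ g n → fails g n ≡ true → ¬ Coherent f F g n
  fails-true⇒incoherent g n eq = xor-true⇒≢ _ _ (proj₂ (∧-true _ _ eq))

  failureFree-sound : ∀ g → failureFree g ≡ true → ∀ n → fails g n ≡ false
  failureFree-sound g free = search-misses (fails g) (not-true _ free)

  failureFree-complete : ∀ g → (∀ n → fails g n ≡ false) → failureFree g ≡ true
  failureFree-complete g none = cong not (none (search (fails g)))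

  agrees-with-X-below : ∀ g a → (∀ m → failsBelow g a m ≡ false) →
                 ∀ k → unpair₂ k <[ f ] a → (g k ≡ᵇ 1) ≡ (X k ≡ᵇ 1)
  agrees-with-X-below g a none k = go k (wf (unpair₂ k))
    where
    go : ∀ k → Acc (λ x y → x <[ f ] y) (unpair₂ k) → unpair₂ k <[ f ] a → (g k ≡ᵇ 1) ≡ (X k ≡ᵇ 1)
    go k (acc rs) d<a = begin
      (g k ≡ᵇ 1)                      ≡⟨ fails-false⇒coherent g k (proj₁ (field-of d a (proj₁ d<a))) no-failure ⟩
      F (below f d g) (unpair₁ k)     ≡⟨ F-ext _ _ (below-cong f d g X λ k' e<d → go k' (rs e<d) (<-trans′ e<d d<a)) (unpair₁ k) ⟩
      F (below f d X) (unpair₁ k)     ≡⟨ X-coherent k ⟨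
      (X k ≡ᵇ 1)                      ∎
      where
      d = unpair₂ k
      no-failure : fails g k ≡ false
      no-failure = begin
        fails g k                  ≡⟨ ∧-identityʳ (fails g k) ⟨
        fails g k ∧ true           ≡⟨ cong (fails g k ∧_) (reflects-true (<ᵇ-reflects f d a) d<a) ⟨
        failsBelow g a k           ≡⟨ none k ⟩
        false                      ∎

  minimalFailure-exists : ∀ g n → fails g n ≡ true → ∃ λ m → minimalFailure g m ≡ true
  minimalFailure-exists g n = go n (wf (unpair₂ n))
    where
    go : ∀ n → Acc (λ x y → x <[ f ] y) (unpair₂ n) → fails g n ≡ true → ∃ λ m → minimalFailure g m ≡ true
    go n (acc rs) fn with failureBelow g (unpair₂ n) in below
    ... | false = n , cong₂ (λ u v → u ∧ not v) fn below
    ... | true  = go m (rs (reflects-sound (<ᵇ-reflects f (unpair₂ m) (unpair₂ n)) (proj₂ m-below))) (proj₁ m-below)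
      where
      m = search (failsBelow g (unpair₂ n))
      m-below = ∧-true _ _ below

  covered⇒fails≡false : ∀ g → (∀ k → k < G g → X k ≡ g k) → ∀ n → fails g n ≡ false
  covered⇒fails≡false g cover n with fails g n in fn
  ... | false = refl
  ... | true  = ⊥-elim (fails-true⇒incoherent g m (proj₁ m-minimal') m-coherent)
    where
    m = firstMinimalFailure g
    m-minimal : minimalFailure g m ≡ true
    m-minimal = search-finds (minimalFailure g) _ (proj₂ (minimalFailure-exists g n fn))
    m-minimal' = ∧-true _ _ m-minimal
    a = unpair₂ m
    none-below : ∀ k → failsBelow g a k ≡ false
    none-below = search-misses (failsBelow g a) (not-true _ (proj₂ m-minimal'))
    covered : X m ≡ g m
    covered = cover m (subst (m <_) (sym (cong (λ b → if b then suc m else 0) m-minimal)) (n<1+n m))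
    m-coherent : Coherent f F g m
    m-coherent = begin
      (g m ≡ᵇ 1)                      ≡⟨ cong (_≡ᵇ 1) covered ⟨
      (X m ≡ᵇ 1)                      ≡⟨ X-coherent m ⟩
      F (below f a X) (unpair₁ m)     ≡⟨ F-ext _ _ (below-cong f a X g λ k k<a → sym (agrees-with-X-below g a none-below k k<a)) (unpair₁ m) ⟩
      F (below f a g) (unpair₁ m)     ∎

nth-binary : ∀ L → All Binary L → ∀ i → Binary (nth L i)
nth-binary []      _          i       n = z≤n
nth-binary (g ∷ L) (g-bin ∷ _) zero    = g-bin
nth-binary (g ∷ L) (_ ∷ L-bin) (suc i) = nth-binary L L-bin i

Any-nth : ∀ {P : (ℕ → ℕ) → Set} L → Any P L → ∃ λ i → P (nth L i)
Any-nth (g ∷ L) (here p)  = zero , p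
Any-nth (g ∷ L) (there p) with Any-nth L p
... | i , q = suc i , q

module Main (μ : (ℕ → ℕ) → ℕ) (μ-spec : IsFeferman μ)
            (Θ : ((ℕ → ℕ) → ℕ) → List (ℕ → ℕ)) (Θ-ext : ExtΘ Θ) (Θ-fan : IsSpecialFan Θ)
            (f : ℕ → ℕ) (F : (ℕ → Bool) → (ℕ → Bool)) (F-ext : ExtF F) where
  open Feferman μ μ-spec
  open Candidates μ μ-spec f F
  open Correctness μ μ-spec Θ Θ-ext f F F-ext

  T : ℕ → ℕ
  T = Tfun Tᴾ μ Θ f F

  T-binary : Binary T
  T-binary n = subst (_≤ 1) (sym (eval-Tᴾ n)) (nth-binary (Θ G) (proj₁ (Θ-fan G)) _ n)

  module _ (wo : IsWellOrdering f) where
    open Analysis μ μ-spec f wo F F-ext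

    chosen-failureFree : ∀ n → fails chosen n ≡ false
    chosen-failureFree = failureFree-sound chosen
      (search-finds (λ i → failureFree (nth (Θ G) i)) (proj₁ covering)
                    (failureFree-complete covered (covered⇒fails≡false covered (proj₂ covering))))
      where
      covering = Any-nth (Θ G) (proj₂ (Θ-fan G) X X-binary)
      covered = nth (Θ G) (proj₁ covering)

    T-recursion : ∀ a → Field f a → ∀ b → (T (pair b a) ≡ᵇ 1) ≡ F (below f a T) b
    T-recursion a a∈f b = begin
      (T (pair b a) ≡ᵇ 1)                                              ≡⟨ cong (_≡ᵇ 1) (eval-Tᴾ (pair b a)) ⟩
      (chosen (pair b a) ≡ᵇ 1)                                         ≡⟨ fails-false⇒coherent chosen (pair b a) a∈f′ (chosen-failureFree (pair b a)) ⟩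
      F (below f (unpair₂ (pair b a)) chosen) (unpair₁ (pair b a))    ≡⟨ cong (λ p → F (below f (proj₂ p) chosen) (proj₁ p)) (unpair-pair b a) ⟩
      F (below f a chosen) b                                           ≡⟨ F-ext _ _ (below-cong f a chosen T λ k _ → cong (_≡ᵇ 1) (sym (eval-Tᴾ k))) b ⟩
      F (below f a T) b                                                ∎
      where
      a∈f′ : Field f (unpair₂ (pair b a))
      a∈f′ = subst (Field f) (sym (cong proj₂ (unpair-pair b a))) a∈f

corollary3p16 : Σ (Prog CtxT) λ e →
    ∀ (μ : (ℕ → ℕ) → ℕ) → IsFeferman μ →
    ∀ (Θ : ((ℕ → ℕ) → ℕ) → List (ℕ → ℕ)) → ExtΘ Θ → IsSpecialFan Θ →
    (∀ (f : ℕ → ℕ) (F : (ℕ → Bool) → (ℕ → Bool)) → ExtF F →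
       ∀ n → Tfun e μ Θ f F n ≤ 1)
    × (∀ (f : ℕ → ℕ) → IsWellOrdering f →
       ∀ (F : (ℕ → Bool) → (ℕ → Bool)) → ExtF F →
       ∀ a → Field f a → ∀ b →
         (Tfun e μ Θ f F (pair b a) ≡ᵇ 1) ≡ F (below f a (Tfun e μ Θ f F)) b)
corollary3p16 = Tᴾ , λ μ μ-spec Θ Θ-ext Θ-fan →
    (λ f F F-ext → Main.T-binary μ μ-spec Θ Θ-ext Θ-fan f F F-ext)
  , (λ f wo F F-ext → Main.T-recursion μ μ-spec Θ Θ-ext Θ-fan f F F-ext wo)
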